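{- Let $\mathcal{P}$ and $\mathcal{B}$ be finite sets of atomic program and test symbols, let $H:\mathrm{Rex}_{\mathcal{P},\mathcal{B}}\to\mathrm{Rex}_{\mathcal{P},\mathcal{B}}$ be an idempotent syntactic homomorphism, and let $E$ be a set of equations between terms of $\mathrm{Rex}_{\mathcal{P},\mathcal{B}}$. Let $H(E)=\{H(r)=H(r') : (r=r')\in E\}$. Then for any $s,t\in\mathrm{Rex}_{\mathcal{P},\mathcal{B}}$ and any Kleene algebra with tests $K$, $$K\models E\wedge E_H\rightarrow s=t \iff K\models H(E)\rightarrow H(s)=H(t).$$
   Context: A Kleene algebra with tests (KAT) is a two-sorted structure $(K,B,+,\cdot,{}^*,\overline{\phantom{x}},0,1)$ where $(K,+,\cdot,{}^*,0,1)$ is a Kleene algebra (an idempotent semiring with partial order $x\le y:\iff x+y=y$ satisfying $1+xx^*\le x^*$, $1+x^*x\le x^*$, $p+qx\le x\rightarrow q^*p\le x$, $p+xq\le x\rightarrow pq^*\le x$) and $B\subseteq K$ with $(B,+,\cdot,\overline{\phantom{x}},0,1)$ a Boolean algebra of tests; $\mathsf{KAT}$ is the class of all KATs. $\mathrm{Rex}_{\mathcal{P},\mathcal{B}}$ is the set of KAT terms over atomic programs $\mathcal{P}$ and atomic tests $\mathcal{B}$ (negation applied only to Boolean terms, i.e., terms built from atomic tests, $0,1,+,\cdot$, negation). An interpretation into a KAT $K$ is a map $I:\mathrm{Rex}_{\mathcal{P},\mathcal{B}}\to K$ that respects all operations and sends atomic tests to tests. A map $H:\mathrm{Rex}_{\mathcal{P},\mathcal{B}}\to\mathrm{Rex}_{\mathcal{P},\mathcal{B}}$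 is a syntactic homomorphism if for every KAT $K$ and every interpretation $I$ into $K$, $I\circ H$ is also an interpretation; it is idempotent if $\mathsf{KAT}\models H(r)=H(H(r))$ for all terms $r$. $E_H$ denotes $\{p=H(p): p\in\mathcal{P}\}\cup\{b=H(b): b\in\mathcal{B}\}$. For a set of equations $F$, $K\models F\rightarrow s=t$ means: for every interpretation $I$ into $K$ satisfying all equations in $F$, $I(s)=I(t)$. -}

module Defs where

open import Level using (Level; _⊔_) renaming (suc to lsuc)
open import Data.Bool using (Bool; true; false; _∧_)
open import Data.Fin using (Fin)
open import Data.Nat using (ℕ)
open import Data.Product using (Σ; ∃; _×_; _,_; proj₁; proj₂)
open import Data.Sum using (_⊎_)
open import Function using (_∘_)
open import Relation.Binary.Core using (Rel)
open import Relation.Binary.PropositionalEquality using (_≡_)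
open import Relation.Unary using (Pred; _∪_)
open import Algebra.Core using (Op₁; Op₂)
open import Algebra.Structures using (IsIdempotentSemiring)
open import Algebra.Lattice.Structures using (IsBooleanAlgebra)

-- The tests form a Boolean algebra B ⊆ K whose
-- operations + , · , 0 , 1 are those of K: we present B as a type
-- `Test` with an embedding ι into K, where two tests are equal iff
-- their images are equal (so B is literally a subset of K), and ι
-- commutes with + , · , 0 , 1.

record KAT (c ℓ : Level) : Set (lsuc (c ⊔ ℓ)) where
  infixl 6 _+_
  infixl 7 _·_
  infix  8 _⋆
  infix  4 _≈_ _≤_
  field
    Carrier : Set c
    _≈_     : Rel Carrier ℓ
    _+_     : Op₂ Carrier
    _·_     : Op₂ Carrier
    _⋆      : Op₁ Carrier
    𝟘       : Carrier
    𝟙       : Carrier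
    isIdempotentSemiring : IsIdempotentSemiring _≈_ _+_ _·_ 𝟘 𝟙

  _≤_ : Rel Carrier ℓ
  x ≤ y = x + y ≈ y

  field
    star-unfoldˡ : ∀ x → 𝟙 + x · (x ⋆) ≤ x ⋆
    star-unfoldʳ : ∀ x → 𝟙 + (x ⋆) · x ≤ x ⋆
    star-indˡ    : ∀ p q x → p + q · x ≤ x → (q ⋆) · p ≤ x
    star-indʳ    : ∀ p q x → p + x · q ≤ x → p · (q ⋆) ≤ x

  field
    Test : Set c
    ι    : Test → Carrier
    _∨ₜ_ : Op₂ Test
    _∧ₜ_ : Op₂ Test
    ¬ₜ_  : Op₁ Test
    ⊤ₜ   : Test
    ⊥ₜ   : Test
    ι-∨  : ∀ a b → ι (a ∨ₜ b) ≈ ι a + ι b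
    ι-∧  : ∀ a b → ι (a ∧ₜ b) ≈ ι a · ι b
    ι-⊤  : ι ⊤ₜ ≈ 𝟙
    ι-⊥  : ι ⊥ₜ ≈ 𝟘
    isBooleanAlgebra :
      IsBooleanAlgebra (λ a b → ι a ≈ ι b) _∨ₜ_ _∧ₜ_ ¬ₜ_ ⊤ₜ ⊥ₜ

  open IsIdempotentSemiring isIdempotentSemiring public

-- The index records whether the term is a Boolean term
-- (built only from atomic tests, 0, 1, +, ·, negation); negation may be
-- applied only to Boolean terms.  Every term of Rex_{P,B} corresponds to
-- exactly one element of  Term np nb = Σ Bool (Tm np nb).

infixl 6 _⊕_
infixl 7 _⊙_

data Tm (np nb : ℕ) : Bool → Set where
  prim : Fin np → Tm np nb false
  test : Fin nb → Tm np nb true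
  zer  : Tm np nb true
  one  : Tm np nb true
  _⊕_  : ∀ {x y} → Tm np nb x → Tm np nb y → Tm np nb (x ∧ y)
  _⊙_  : ∀ {x y} → Tm np nb x → Tm np nb y → Tm np nb (x ∧ y)
  star : ∀ {x} → Tm np nb x → Tm np nb false
  neg  : Tm np nb true → Tm np nb true

Rex : ℕ → ℕ → Set
Rex np nb = Σ Bool (Tm np nb)

⌜_⌝ : ∀ {np nb x} → Tm np nb x → Rex np nb
⌜_⌝ {x = x} t = x , t

module _ {c ℓ : Level} (K : KAT c ℓ) {np nb : ℕ} where
  open KAT K

  record IsInterpretation (I : Rex np nb → Carrier) : Set (c ⊔ ℓ) where
    field
      resp-zero : I ⌜ zer ⌝ ≈ 𝟘
      resp-one  : I ⌜ one ⌝ ≈ 𝟙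
      resp-plus : ∀ {x y} (s : Tm np nb x) (t : Tm np nb y) →
                  I ⌜ s ⊕ t ⌝ ≈ I ⌜ s ⌝ + I ⌜ t ⌝
      resp-dot  : ∀ {x y} (s : Tm np nb x) (t : Tm np nb y) →
                  I ⌜ s ⊙ t ⌝ ≈ I ⌜ s ⌝ · I ⌜ t ⌝
      resp-star : ∀ {x} (s : Tm np nb x) → I ⌜ star s ⌝ ≈ (I ⌜ s ⌝) ⋆
      test-test : ∀ b → ∃ λ (β : Test) → ι β ≈ I ⌜ test b ⌝
      resp-neg  : ∀ (e : Tm np nb true) (β : Test) → ι β ≈ I ⌜ e ⌝ →
                  I ⌜ neg e ⌝ ≈ ι (¬ₜ β)

  Eqn : Set
  Eqn = Rex np nb × Rex np nb

  Satisfies : ∀ {e} → (Rex np nb → Carrier) → Pred Eqn e → Set _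
  Satisfies I F = ∀ r r' → F (r , r') → I r ≈ I r'

  -- K ⊨ F → s = t   is written   F ⊨ s ≐ t   (K the module parameter)
  _⊨_≐_ : ∀ {e} → Pred Eqn e → Rex np nb → Rex np nb → Set _
  F ⊨ s ≐ t = ∀ (I : Rex np nb → Carrier) → IsInterpretation I →
               Satisfies I F → I s ≈ I t

module _ {np nb : ℕ} where

  Equation : Set
  Equation = Rex np nb × Rex np nb

  KAT⊨_≐_ : ∀ {c ℓ} → Rex np nb → Rex np nb → Set (lsuc (c ⊔ ℓ))
  KAT⊨_≐_ {c} {ℓ} s t = ∀ (K : KAT c ℓ) (I : Rex np nb → KAT.Carrier K) →
                   IsInterpretation K I → KAT._≈_ K (I s) (I t)

  IsSyntacticHom : ∀ c ℓ → (Rex np nb → Rex np nb) → Set (lsuc (c ⊔ ℓ))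
  IsSyntacticHom c ℓ H = ∀ (K : KAT c ℓ) (I : Rex np nb → KAT.Carrier K) →
                        IsInterpretation K I → IsInterpretation K (I ∘ H)

  IsIdempotent : ∀ c ℓ → (Rex np nb → Rex np nb) → Set (lsuc (c ⊔ ℓ))
  IsIdempotent c ℓ H = ∀ r → KAT⊨_≐_ {c} {ℓ} (H r) (H (H r))

  E[_] : (Rex np nb → Rex np nb) → Pred Equation Level.zero
  E[ H ] eq = (∃ λ p → eq ≡ (⌜ prim p ⌝ , H ⌜ prim p ⌝))
            ⊎ (∃ λ b → eq ≡ (⌜ test b ⌝ , H ⌜ test b ⌝))

  image : ∀ {e} → (Rex np nb → Rex np nb) → Pred Equation e → Pred Equation e
  image H E eq = ∃ λ r → ∃ λ r' → E (r , r') × eq ≡ (H r , H r')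

{-# OPTIONS --safe #-}
-- An interpretation is determined by its values on atoms.  So if I satisfies
-- E_H, then I and I ∘ H (an interpretation, H being a syntactic homomorphism)
-- coincide, which turns E and s = t into H(E) and H(s) = H(t).  Conversely,
-- for I satisfying H(E), the interpretation I ∘ H satisfies E, and it satisfies
-- E_H because H is idempotent.
module Submission where

open import Defs
open import Level using (Level)
open import Data.Nat using (ℕ)
open import Data.Bool using (true)
open import Data.Product using (∃; _,_)
open import Data.Sum using (inj₁; inj₂)
open import Function using (_∘_)
open import Relation.Unary using (Pred; _∪_)
open import Relation.Binary.PropositionalEquality using (_≡_; refl)
open import Function.Bundles using (_⇔_; mk⇔; Equivalence)
open import Algebra.Lattice.Structures using (module IsBooleanAlgebra)

module _ {c ℓ : Level} (K : KAT c ℓ) where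
  open KAT K renaming (refl to ≈-refl)
  open IsBooleanAlgebra isBooleanAlgebra using (¬-cong)

  ≤-antisym : ∀ {x y} → x ≤ y → y ≤ x → x ≈ y
  ≤-antisym x≤y y≤x = trans (sym y≤x) (trans (+-comm _ _) x≤y)

  ≤-respˡ-≈ : ∀ {x x′ y} → x ≈ x′ → x ≤ y → x′ ≤ y
  ≤-respˡ-≈ x≈x′ x≤y = trans (+-cong (sym x≈x′) ≈-refl) x≤y

  ⋆-mono-≈ : ∀ {x y} → x ≈ y → x ⋆ ≤ y ⋆
  ⋆-mono-≈ {x} {y} x≈y = ≤-respˡ-≈ (*-identityˡ (x ⋆)) (star-indʳ 𝟙 x (y ⋆) unfold)
    where
    unfold : 𝟙 + y ⋆ · x ≤ y ⋆
    unfold = ≤-respˡ-≈ (+-cong ≈-refl (*-cong ≈-refl (sym x≈y))) (star-unfoldʳ y)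

  ⋆-cong : ∀ {x y} → x ≈ y → x ⋆ ≈ y ⋆
  ⋆-cong x≈y = ≤-antisym (⋆-mono-≈ x≈y) (⋆-mono-≈ (sym x≈y))

  module _ {np nb : ℕ} where

    module _ {I : Rex np nb → Carrier} (isI : IsInterpretation K I) where
      open IsInterpretation isI

      boolean⇒test : ∀ {x} (e : Tm np nb x) → x ≡ true → ∃ λ β → ι β ≈ I ⌜ e ⌝
      boolean⇒test (test b) _ = test-test b
      boolean⇒test zer _ = ⊥ₜ , trans ι-⊥ (sym resp-zero)
      boolean⇒test one _ = ⊤ₜ , trans ι-⊤ (sym resp-one)
      boolean⇒test (_⊕_ {true} {true} a b) _
        with α , ια≈a ← boolean⇒test a refl | β , ιβ≈b ← boolean⇒test b refl
        = α ∨ₜ β , trans (ι-∨ α β) (trans (+-cong ια≈a ιβ≈b) (sym (resp-plus a b)))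
      boolean⇒test (_⊙_ {true} {true} a b) _
        with α , ια≈a ← boolean⇒test a refl | β , ιβ≈b ← boolean⇒test b refl
        = α ∧ₜ β , trans (ι-∧ α β) (trans (*-cong ια≈a ιβ≈b) (sym (resp-dot a b)))
      boolean⇒test (neg e) _
        with β , ιβ≈e ← boolean⇒test e refl
        = ¬ₜ β , sym (resp-neg e β ιβ≈e)

    agree-on-atoms⇒agree : ∀ {I J} → IsInterpretation K I → IsInterpretation K J →
      (∀ p → I ⌜ prim p ⌝ ≈ J ⌜ prim p ⌝) → (∀ b → I ⌜ test b ⌝ ≈ J ⌜ test b ⌝) →
      ∀ r → I r ≈ J r
    agree-on-atoms⇒agree {I} {J} isI isJ prim≈ test≈ (_ , r) = go r
      where
      module I = IsInterpretation isI
      module J = IsInterpretation isJ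
      go : ∀ {x} (r : Tm np nb x) → I ⌜ r ⌝ ≈ J ⌜ r ⌝
      go (prim p) = prim≈ p
      go (test b) = test≈ b
      go zer      = trans I.resp-zero (sym J.resp-zero)
      go one      = trans I.resp-one (sym J.resp-one)
      go (a ⊕ b)  = trans (I.resp-plus a b) (trans (+-cong (go a) (go b)) (sym (J.resp-plus a b)))
      go (a ⊙ b)  = trans (I.resp-dot a b) (trans (*-cong (go a) (go b)) (sym (J.resp-dot a b)))
      go (star a) = trans (I.resp-star a) (trans (⋆-cong (go a)) (sym (J.resp-star a)))
      go (neg e)
        with β , ιβ≈Ie ← boolean⇒test isI e refl | γ , ιγ≈Je ← boolean⇒test isJ e refl
        = trans (I.resp-neg e β ιβ≈Ie)
            (trans (¬-cong (trans ιβ≈Ie (trans (go e) (sym ιγ≈Je)))) (sym (J.resp-neg e γ ιγ≈Je)))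

module _ {c ℓ : Level} {np nb : ℕ} {H : Rex np nb → Rex np nb} (K : KAT c ℓ) where
  open KAT K hiding (refl)

  satisfies-E[H]⇒invariant : IsSyntacticHom c ℓ H →
    ∀ {I} → IsInterpretation K I → Satisfies K I E[ H ] → ∀ r → I r ≈ I (H r)
  satisfies-E[H]⇒invariant hom {I} isI sat = agree-on-atoms⇒agree K isI (hom K I isI)
    (λ p → sat _ _ (inj₁ (p , refl)))
    (λ b → sat _ _ (inj₂ (b , refl)))

  idempotent⇒satisfies-E[H] : IsIdempotent c ℓ H →
    ∀ {I} → IsInterpretation K I → Satisfies K (I ∘ H) E[ H ]
  idempotent⇒satisfies-E[H] idem {I} isI _ _ (inj₁ (p , refl)) = idem ⌜ prim p ⌝ K I isI
  idempotent⇒satisfies-E[H] idem {I} isI _ _ (inj₂ (b , refl)) = idem ⌜ test b ⌝ K I isI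

  satisfies-image⇔satisfies-∘ : ∀ {e} {E : Pred Equation e} {I} →
    Satisfies K I (image H E) ⇔ Satisfies K (I ∘ H) E
  satisfies-image⇔satisfies-∘ = mk⇔
    (λ sat r r′ r=r′ → sat (H r) (H r′) (r , r′ , r=r′ , refl))
    (λ { sat _ _ (r , r′ , r=r′ , refl) → sat r r′ r=r′ })

theorem13 : ∀ {c ℓ e : Level} {np nb : ℕ} (H : Rex np nb → Rex np nb) →
    IsSyntacticHom c ℓ H → IsIdempotent c ℓ H →
    (E : Pred (Equation {np} {nb}) e) (s t : Rex np nb) (K : KAT c ℓ) →
    (_⊨_≐_ K (E ∪ E[ H ]) s t) ⇔ (_⊨_≐_ K (image H E) (H s) (H t))
theorem13 H hom idem E s t K = mk⇔ forward backward
  where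
  open KAT K hiding (refl)
  open Equivalence using (to; from)

  forward : _⊨_≐_ K (E ∪ E[ H ]) s t → _⊨_≐_ K (image H E) (H s) (H t)
  forward E⊨s≐t I isI sat = E⊨s≐t (I ∘ H) (hom K I isI) λ where
    r r′ (inj₁ r=r′) → to (satisfies-image⇔satisfies-∘ K) sat r r′ r=r′
    r r′ (inj₂ r=Hr) → idempotent⇒satisfies-E[H] K idem isI r r′ r=Hr

  backward : _⊨_≐_ K (image H E) (H s) (H t) → _⊨_≐_ K (E ∪ E[ H ]) s t
  backward HE⊨Hs≐Ht I isI sat = trans (I≈I∘H s) (trans (HE⊨Hs≐Ht I isI satᴴ) (sym (I≈I∘H t)))
    where
    I≈I∘H : ∀ r → I r ≈ I (H r)
    I≈I∘H = satisfies-E[H]⇒invariant K hom isI (λ r r′ → sat r r′ ∘ inj₂)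
    satᴴ : Satisfies K I (image H E)
    satᴴ = from (satisfies-image⇔satisfies-∘ K) λ r r′ r=r′ →
      trans (sym (I≈I∘H r)) (trans (sat r r′ (inj₁ r=r′)) (I≈I∘H r′))
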